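{- Let $\langle A,\succ,1\rangle$ be a ${\rm G}_4^0$-algebra with least element $0$. Define $\sim x=x\succ 0$, $x\multimap y=x\succ(x\succ y)$, $\nabla x=\sim x\succ x$, $x\vee y=(x\succ y)\succ y$ and $x\wedge y=\sim(\sim x\vee\sim y)$. Then the following identities (each quantified over all $x\in A$) are equivalent: (G'35) $\nabla x\multimap 0=\nabla x\succ 0$; (G'36) $\sim\nabla x\succ\nabla x=\nabla x$; (G'37) $\sim\nabla x\vee\nabla x=1$; (G'38) $\nabla x\wedge\sim\nabla x=0$.
   Context: A G-algebra is an algebra $\langle A,\succ,1\rangle$ of type $(2,0)$ satisfying for all $x,y,z$: (G1) $1\succ x=x$; (G2) $x\succ 1=1$; (G3) $(x\succ y)\succ y=(y\succ x)\succ x$; (G4) if $x\succ(y\succ z)=1$ then $y\succ(x\succ z)=1$. The relation $x\leq y$ iff $x\succ y=1$ is a partial order, with join $x\vee y=(x\succ y)\succ y$. A ${\rm G}^0$-algebra is a G-algebra with an element $0$ such that $0\leq x$ for all $x$. A ${\rm G}_4^0$-algebra is a ${\rm G}^0$-algebra satisfying $((x\succ(x\succ y))\succ x)\succ x=1$ for all $x,y$. -}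

module Defs where

open import Level using (Level; suc)
open import Relation.Binary.PropositionalEquality using (_≡_)

record GAlgebra (a : Level) : Set (suc a) where
  infixr 5 _≻_
  field
    Carrier : Set a
    _≻_     : Carrier → Carrier → Carrier
    𝟙       : Carrier
    G1 : ∀ x → 𝟙 ≻ x ≡ x
    G2 : ∀ x → x ≻ 𝟙 ≡ 𝟙
    G3 : ∀ x y → (x ≻ y) ≻ y ≡ (y ≻ x) ≻ x
    G4 : ∀ x y z → x ≻ (y ≻ z) ≡ 𝟙 → y ≻ (x ≻ z) ≡ 𝟙

  _≤_ : Carrier → Carrier → Set a
  x ≤ y = x ≻ y ≡ 𝟙

record G0Algebra (a : Level) : Set (suc a) where
  field
    gAlgebra : GAlgebra a
  open GAlgebra gAlgebra public
  field
    𝟘     : Carrier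
    least : ∀ x → 𝟘 ≤ x

record G04Algebra (a : Level) : Set (suc a) where
  field
    g0Algebra : G0Algebra a
  open G0Algebra g0Algebra public
  field
    G4ax : ∀ x y → ((x ≻ (x ≻ y)) ≻ x) ≻ x ≡ 𝟙

  ∼_ : Carrier → Carrier
  ∼ x = x ≻ 𝟘

  _⊸_ : Carrier → Carrier → Carrier
  x ⊸ y = x ≻ (x ≻ y)

  ∇_ : Carrier → Carrier
  ∇ x = (∼ x) ≻ x

  _∨_ : Carrier → Carrier → Carrier
  x ∨ y = (x ≻ y) ≻ y

  _∧_ : Carrier → Carrier → Carrier
  x ∧ y = ∼ ((∼ x) ∨ (∼ y))

  G'35 : Set a
  G'35 = ∀ x → (∇ x) ⊸ 𝟘 ≡ (∇ x) ≻ 𝟘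

  G'36 : Set a
  G'36 = ∀ x → (∼ (∇ x)) ≻ (∇ x) ≡ ∇ x

  G'37 : Set a
  G'37 = ∀ x → (∼ (∇ x)) ∨ (∇ x) ≡ 𝟙

  G'38 : Set a
  G'38 = ∀ x → (∇ x) ∧ (∼ (∇ x)) ≡ 𝟘

module Submission where

open import Defs
open import Level using (Level)
open import Data.Product using (_×_; _,_)
open import Function.Bundles using (_⇔_; mk⇔; Equivalence)
open import Relation.Binary.PropositionalEquality
open ≡-Reasoning

-- The four identities are equivalent pointwise, for an arbitrary element d in
-- place of ∇ x.  Since ∼ ∼ d = d, (G'38) is the negation of (G'37), and (G'37)
-- says ∼ d ≻ d ≤ d, the converse of d ≤ ∼ d ≻ d.  If d ⊸ 0 = ∼ d, the G⁰₄ axiom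
-- at (d, 0) gives that same inequality; conversely (G'36) and the exchange law
-- (G3) give d ⊸ 0 ≤ ∼ d, the converse of ∼ d ≤ d ≻ ∼ d.

∀-⇔ : ∀ {a p q} {A : Set a} {P : A → Set p} {Q : A → Set q} →
      (∀ x → P x ⇔ Q x) → (∀ x → P x) ⇔ (∀ x → Q x)
∀-⇔ P⇔Q = mk⇔ (λ p x → Equivalence.to (P⇔Q x) (p x))
              (λ q x → Equivalence.from (P⇔Q x) (q x))

module GAlgebraProperties {a : Level} (G : GAlgebra a) where
  open GAlgebra G

  ≤-refl : ∀ x → x ≤ x
  ≤-refl x = begin
    x ≻ x         ≡⟨ cong (_≻ x) (sym (G1 x)) ⟩
    (𝟙 ≻ x) ≻ x   ≡⟨ sym (G3 x 𝟙) ⟩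
    (x ≻ 𝟙) ≻ 𝟙   ≡⟨ cong (_≻ 𝟙) (G2 x) ⟩
    𝟙 ≻ 𝟙         ≡⟨ G2 𝟙 ⟩
    𝟙             ∎

  ≤-antisym : ∀ {x y} → x ≤ y → y ≤ x → x ≡ y
  ≤-antisym {x} {y} x≤y y≤x = begin
    x             ≡⟨ sym (G1 x) ⟩
    𝟙 ≻ x         ≡⟨ cong (_≻ x) (sym y≤x) ⟩
    (y ≻ x) ≻ x   ≡⟨ sym (G3 x y) ⟩
    (x ≻ y) ≻ y   ≡⟨ cong (_≻ y) x≤y ⟩
    𝟙 ≻ y         ≡⟨ G1 y ⟩
    y             ∎

  y≤x≻y : ∀ x y → y ≤ (x ≻ y)
  y≤x≻y x y = G4 x y y (trans (cong (x ≻_) (≤-refl y)) (G2 x))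

module G0AlgebraProperties {a : Level} (G : G0Algebra a) where
  open G0Algebra G
  open GAlgebraProperties gAlgebra

  ≻𝟘-involutive : ∀ x → (x ≻ 𝟘) ≻ 𝟘 ≡ x
  ≻𝟘-involutive x = begin
    (x ≻ 𝟘) ≻ 𝟘   ≡⟨ G3 x 𝟘 ⟩
    (𝟘 ≻ x) ≻ x   ≡⟨ cong (_≻ x) (least x) ⟩
    𝟙 ≻ x         ≡⟨ G1 x ⟩
    x             ∎

module G04AlgebraProperties {a : Level} (A : G04Algebra a) where
  open G04Algebra A
  open GAlgebraProperties gAlgebra
  open G0AlgebraProperties g0Algebra

  ⊸𝟘≡∼⇔∼≻≡ : ∀ d → d ⊸ 𝟘 ≡ ∼ d ⇔ (∼ d) ≻ d ≡ d
  ⊸𝟘≡∼⇔∼≻≡ d = mk⇔ to from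
    where
    to : d ⊸ 𝟘 ≡ ∼ d → (∼ d) ≻ d ≡ d
    to eq = ≤-antisym (subst (λ t → (t ≻ d) ≻ d ≡ 𝟙) eq (G4ax d 𝟘)) (y≤x≻y (∼ d) d)

    from : (∼ d) ≻ d ≡ d → d ⊸ 𝟘 ≡ ∼ d
    from eq = ≤-antisym d⊸𝟘≤∼d (y≤x≻y d (∼ d))
      where
      d⊸𝟘≤∼d : (d ⊸ 𝟘) ≤ (∼ d)
      d⊸𝟘≤∼d = begin
        (d ≻ ∼ d) ≻ ∼ d   ≡⟨ sym (G3 (∼ d) d) ⟩
        ((∼ d) ≻ d) ≻ d   ≡⟨ cong (_≻ d) eq ⟩
        d ≻ d             ≡⟨ ≤-refl d ⟩
        𝟙                 ∎

  ∼≻≡⇔∼∨≡𝟙 : ∀ d → (∼ d) ≻ d ≡ d ⇔ (∼ d) ∨ d ≡ 𝟙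
  ∼≻≡⇔∼∨≡𝟙 d = mk⇔ (λ eq → trans (cong (_≻ d) eq) (≤-refl d))
                   (λ eq → ≤-antisym eq (y≤x≻y (∼ d) d))

  ∼∨≡𝟙⇔∧∼≡𝟘 : ∀ d → (∼ d) ∨ d ≡ 𝟙 ⇔ d ∧ (∼ d) ≡ 𝟘
  ∼∨≡𝟙⇔∧∼≡𝟘 d = mk⇔ to from
    where
    ∧∼≡∼∨ : d ∧ (∼ d) ≡ ∼ ((∼ d) ∨ d)
    ∧∼≡∼∨ = cong (λ t → ∼ ((∼ d) ∨ t)) (≻𝟘-involutive d)

    to : (∼ d) ∨ d ≡ 𝟙 → d ∧ (∼ d) ≡ 𝟘
    to eq = trans ∧∼≡∼∨ (trans (cong ∼_ eq) (G1 𝟘))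

    from : d ∧ (∼ d) ≡ 𝟘 → (∼ d) ∨ d ≡ 𝟙
    from eq = begin
      (∼ d) ∨ d           ≡⟨ sym (≻𝟘-involutive _) ⟩
      ∼ (∼ ((∼ d) ∨ d))   ≡⟨ cong ∼_ (sym ∧∼≡∼∨) ⟩
      ∼ (d ∧ (∼ d))       ≡⟨ cong ∼_ eq ⟩
      ∼ 𝟘                 ≡⟨ ≤-refl 𝟘 ⟩
      𝟙                   ∎

lemma3p5 : ∀ {a : Level} (A : G04Algebra a) →
    let open G04Algebra A in
    (G'35 ⇔ G'36) × (G'36 ⇔ G'37) × (G'37 ⇔ G'38)
lemma3p5 A =
    ∀-⇔ (λ x → ⊸𝟘≡∼⇔∼≻≡ (∇ x))
  , ∀-⇔ (λ x → ∼≻≡⇔∼∨≡𝟙 (∇ x))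
  , ∀-⇔ (λ x → ∼∨≡𝟙⇔∧∼≡𝟘 (∇ x))
  where
  open G04Algebra A
  open G04AlgebraProperties A
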